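{- Let $P_k$ denote the path with $k$ vertices and $C_k$ the cycle with $k$ vertices. Then: $\chi_{D_L}(P_{2t})=2$ and $\chi_{D_L}(P_{2t+1})=3$ for every $t\geq 1$; $\chi_{D_L}(C_4)=4$, $\chi_{D_L}(C_5)=3$, $\chi_{D_L}(C_6)=4$; $\chi_{D_L}(C_{2m+1})=3$ for every $m\geq 3$; $\chi_{D_L}(C_{2n})=3$ for every $n\geq 4$.
   Context: A vertex coloring $f$ of a graph $G$ is distinguishing if the only automorphism $\phi$ of $G$ with $f(\phi(v))=f(v)$ for all vertices $v$ is the identity. A list assignment $L=\{L(v)\}_{v\in V(G)}$ assigns to each vertex a finite set of colors; $G$ is properly $L$-distinguishable if there is a proper vertex coloring $f$ of $G$ which is distinguishing and satisfies $f(v)\in L(v)$ for all $v$. The list-distinguishing chromatic number $\chi_{D_L}(G)$ is the minimum integer $k$ such that $G$ is properly $L$-distinguishable for every list assignment $L$ with $|L(v)|=k$ for all $v\in V(G)$. -}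

module Defs where

open import Data.Nat using (ℕ; zero; suc; _+_; _*_; _<_; _%_)
open import Data.Fin using (Fin; toℕ)
open import Data.Fin.Permutation using (Permutation′; _⟨$⟩ʳ_)
open import Data.Product using (Σ; _×_; ∃; proj₁)
open import Data.Sum using (_⊎_)
open import Function.Definitions using (Injective)
open import Relation.Binary.PropositionalEquality using (_≡_; _≢_)
open import Relation.Nullary using (¬_)

record Graph : Set₁ where
  field
    n   : ℕ
    Adj : Fin n → Fin n → Set
open Graph public

Path : ℕ → Graph
Path k = record { n = k ; Adj = λ i j → (toℕ j ≡ suc (toℕ i)) ⊎ (toℕ i ≡ suc (toℕ j)) }

Cycle : ℕ → Graph
Cycle k@(suc m) = record { n = k ; Adj = λ i j → (toℕ j ≡ suc (toℕ i) % k) ⊎ (toℕ i ≡ suc (toℕ j) % k) }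
Cycle zero = record { n = zero ; Adj = λ _ _ → Fin zero }

IsAutomorphism : (G : Graph) → Permutation′ (n G) → Set
IsAutomorphism G φ = ∀ u v → (Adj G u v → Adj G (φ ⟨$⟩ʳ u) (φ ⟨$⟩ʳ v))
                           × (Adj G (φ ⟨$⟩ʳ u) (φ ⟨$⟩ʳ v) → Adj G u v)

Coloring : Graph → Set
Coloring G = Fin (n G) → ℕ

IsProper : (G : Graph) → Coloring G → Set
IsProper G f = ∀ u v → Adj G u v → f u ≢ f v

IsDistinguishing : (G : Graph) → Coloring G → Set
IsDistinguishing G f = (φ : Permutation′ (n G)) → IsAutomorphism G φ →
                       (∀ v → f (φ ⟨$⟩ʳ v) ≡ f v) → ∀ v → φ ⟨$⟩ʳ v ≡ v

-- A list assignment with lists of size k: each L v is a k-element set of colours,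
-- represented as an injective enumeration Fin k → ℕ.
ListAssignment : Graph → ℕ → Set
ListAssignment G k = Σ (Fin (n G) → Fin k → ℕ) λ L → ∀ v → Injective _≡_ _≡_ (L v)

RespectsLists : (G : Graph) {k : ℕ} → ListAssignment G k → Coloring G → Set
RespectsLists G {k} L f = ∀ v → ∃ λ (i : Fin k) → proj₁ L v i ≡ f v

ProperlyLDistinguishable : (G : Graph) {k : ℕ} → ListAssignment G k → Set
ProperlyLDistinguishable G L =
  ∃ λ (f : Coloring G) → IsProper G f × IsDistinguishing G f × RespectsLists G L f

ListDistinguishableWith : Graph → ℕ → Set
ListDistinguishableWith G k = (L : ListAssignment G k) → ProperlyLDistinguishable G L

χDL≡ : Graph → ℕ → Set
χDL≡ G k = ListDistinguishableWith G k × (∀ j → j < k → ¬ ListDistinguishableWith G j)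

-- Lower bounds: one color cannot properly color an edge; a proper 2-coloring of a
-- cycle is invariant under the rotation by two steps, and one of a path with an odd number of
-- vertices under the reversal; for C₄ and C₆ an exhaustive search shows that every proper coloring
-- with three colors is fixed by a nontrivial rotation or reflection.
-- Upper bounds: an automorphism of a path or cycle is determined by the images of two adjacent
-- vertices, so it is the identity or the reversal of a path, and a rotation or reflection of a
-- cycle.  Paths are colored greedily, for an odd number of vertices reserving the color of the
-- first vertex.  On a cycle it suffices that vertex 0 carries a color used nowhere else and that
-- its two neighbours get different colors; this can be arranged with four colors per list, and
-- with three unless all lists are equal.  Equal lists {c₀, c₁, c₂} are handled by the fixed
-- pattern c₂ c₀ c₁ c₂ c₀ c₁ c₀ c₁ …, which is distinguishing on every cycle of length ≥ 5 except C₆.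
module Submission where

open import Defs
open import Data.Nat using (ℕ; zero; suc; pred; _+_; _*_; _∸_; _%_; _≤_; _<_; _≥_; _≤′_; ≤′-refl; ≤′-step; z≤n; s≤s; _≟_)
open import Data.Nat.Properties
open import Data.Nat.DivMod using (_mod_; m%n<n; m≤n⇒m%n≡m; m%n%n≡m%n; %-distribˡ-+; [m+n]%n≡m%n; n%n≡0)
open import Data.Fin using (Fin; toℕ; opposite)
import Data.Fin.Properties as Fin
open import Data.Fin.Patterns using (0F; 1F; 2F)
open import Data.Fin.Permutation using (Permutation′; _⟨$⟩ʳ_; _⟨$⟩ˡ_; inverseˡ; inverseʳ; permutation; reverse; _∘ₚ_; flip)
open import Data.List using (List; []; _∷_; length)
import Data.List as List
open import Data.List.Membership.Propositional using (_∈_; _∉_)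
open import Data.List.Membership.DecPropositional _≟_ using (_∈?_)
open import Data.List.Relation.Unary.Any using (here; there; index)
open import Data.List.Relation.Unary.Any.Properties using (lookup-index)
open import Data.Vec using (Vec; lookup; tabulate)
import Data.Vec as Vec
open import Data.Vec.Properties using (lookup∘tabulate)
open import Data.Product using (_×_; _,_; ∃; proj₁; proj₂)
open import Data.Sum using (_⊎_; inj₁; inj₂; [_,_]′)
open import Data.Empty using (⊥; ⊥-elim)
open import Data.Unit using (tt)
open import Function using (_∘_)
open import Function.Bundles using (Injection)
open import Function.Definitions using (Injective)
open import Function.Properties.Inverse using (↔⇒↣)
open import Relation.Binary.PropositionalEquality
open import Relation.Nullary using (¬_; yes; no; ¬?; Dec; map′)
open import Relation.Nullary.Decidable using (decidable-stable; _×-dec_; _⊎-dec_; toWitness)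

-- Lists of colors

infix 4 _∈ₗ_ _⊆ₗ_

_∈ₗ_ : ∀ {k} → ℕ → (Fin k → ℕ) → Set
c ∈ₗ ℓ = ∃ λ i → ℓ i ≡ c

_∈ₗ?_ : ∀ {k} (c : ℕ) (ℓ : Fin k → ℕ) → Dec (c ∈ₗ ℓ)
c ∈ₗ? ℓ = Fin.any? (λ i → ℓ i ≟ c)

_⊆ₗ_ : ∀ {j k} → (Fin j → ℕ) → (Fin k → ℕ) → Set
ℓ ⊆ₗ ℓ′ = ∀ i → ℓ i ∈ₗ ℓ′

∈ₗ-⊆ₗ : ∀ {j k c} {ℓ : Fin j → ℕ} {ℓ′ : Fin k → ℕ} → c ∈ₗ ℓ → ℓ ⊆ₗ ℓ′ → c ∈ₗ ℓ′
∈ₗ-⊆ₗ (i , refl) ℓ⊆ℓ′ = ℓ⊆ℓ′ i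

injective-⊈ : ∀ {k} {ℓ : Fin k → ℕ} → Injective _≡_ _≡_ ℓ → (cs : List ℕ) → length cs < k →
              ¬ (∀ i → ℓ i ∈ cs)
injective-⊈ {ℓ = ℓ} ℓ-injective cs cs<k occurs
  with i , j , i<j , same-index ← Fin.pigeonhole cs<k (λ i → index (occurs i)) =
  Fin.<⇒≢ i<j (ℓ-injective (begin
    ℓ i                               ≡⟨ lookup-index (occurs i) ⟩
    List.lookup cs (index (occurs i)) ≡⟨ cong (List.lookup cs) same-index ⟩
    List.lookup cs (index (occurs j)) ≡⟨ lookup-index (occurs j) ⟨
    ℓ j                               ∎))
  where open ≡-Reasoning

fresh : ∀ {k} (ℓ : Fin k → ℕ) → Injective _≡_ _≡_ ℓ → (cs : List ℕ) → length cs < k →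
        ∃ λ c → c ∈ₗ ℓ × c ∉ cs
fresh ℓ ℓ-injective cs cs<k with Fin.any? (λ i → ¬? (ℓ i ∈? cs))
... | yes (i , ℓi∉cs) = ℓ i , (i , refl) , ℓi∉cs
... | no ∄ = ⊥-elim (injective-⊈ ℓ-injective cs cs<k
                       (λ i → decidable-stable (ℓ i ∈? cs) (λ ℓi∉cs → ∄ (i , ℓi∉cs))))

module Greedy {k} (ℓ : ℕ → Fin k → ℕ) (ℓ-injective : ∀ j → Injective _≡_ _≡_ (ℓ j))
              (reserved : List ℕ) (room : suc (length reserved) < k) where

  mutual
    color : ℕ → ℕ
    color j = proj₁ (choice j)

    forbidden : ℕ → List ℕ
    forbidden zero    = reserved
    forbidden (suc j) = color j ∷ reserved

    choice : ∀ j → ∃ λ c → c ∈ₗ ℓ j × c ∉ forbidden j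
    choice zero    = fresh (ℓ zero) (ℓ-injective zero) reserved (<-trans (n<1+n _) room)
    choice (suc j) = fresh (ℓ (suc j)) (ℓ-injective (suc j)) (color j ∷ reserved) room

  color-∈ : ∀ j → color j ∈ₗ ℓ j
  color-∈ j = proj₁ (proj₂ (choice j))

  color-step : ∀ j → color (suc j) ≢ color j
  color-step j eq = proj₂ (proj₂ (choice (suc j))) (here eq)

  color-∉-reserved : ∀ j → color j ∉ reserved
  color-∉-reserved zero    = proj₂ (proj₂ (choice zero))
  color-∉-reserved (suc j) = proj₂ (proj₂ (choice (suc j))) ∘ there

-- List-distinguishability

ListDistinguishableWith-suc : ∀ {G k} → ListDistinguishableWith G k → ListDistinguishableWith G (suc k)
ListDistinguishableWith-suc ld (L , L-injective)
  with f , proper , distinguishing , respects ←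
         ld ((λ v → L v ∘ Fin.suc) , (λ v → Fin.suc-injective ∘ L-injective v)) =
  f , proper , distinguishing , λ v → Fin.suc (proj₁ (respects v)) , proj₂ (respects v)

ListDistinguishableWith-mono : ∀ {G j k} → j ≤ k → ListDistinguishableWith G j → ListDistinguishableWith G k
ListDistinguishableWith-mono = mono′ ∘ ≤⇒≤′
  where
  mono′ : ∀ {G j k} → j ≤′ k → ListDistinguishableWith G j → ListDistinguishableWith G k
  mono′ ≤′-refl        ld = ld
  mono′ (≤′-step j≤′k) ld = ListDistinguishableWith-suc (mono′ j≤′k ld)

χDL≡-intro : ∀ {G k} → ListDistinguishableWith G (suc k) → ¬ ListDistinguishableWith G k → χDL≡ G (suc k)
χDL≡-intro ld ¬ld = ld , λ j j<1+k ldj → ¬ld (ListDistinguishableWith-mono (≤-pred j<1+k) ldj)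

module _ {G : Graph} where

  standardLists : (k : ℕ) → ListAssignment G k
  standardLists k = (λ _ → toℕ) , (λ _ → Fin.toℕ-injective)

  -- Colorings from the lists {0, …, k − 1}, as vectors so that they can be enumerated.
  ProperDistinguishing : ℕ → Set
  ProperDistinguishing k =
    ∃ λ (g : Vec (Fin k) (n G)) → IsProper G (toℕ ∘ lookup g) × IsDistinguishing G (toℕ ∘ lookup g)

  ListDistinguishableWith⇒ProperDistinguishing : ∀ {k} → ListDistinguishableWith G k → ProperDistinguishing k
  ListDistinguishableWith⇒ProperDistinguishing {k} ld with f , proper , distinguishing , respects ← ld (standardLists k) =
    g , (λ u v a eq → proper u v a (trans (f≗g u) (trans eq (sym (f≗g v))))) ,
    (λ φ φ-aut preserves → distinguishing φ φ-aut (λ v → trans (f≗g _) (trans (preserves v) (sym (f≗g v)))))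
    where
    g = tabulate (proj₁ ∘ respects)
    f≗g : ∀ v → f v ≡ toℕ (lookup g v)
    f≗g v = trans (sym (proj₂ (respects v))) (cong toℕ (sym (lookup∘tabulate (proj₁ ∘ respects) v)))

  edge⇒¬ProperDistinguishing₁ : ∀ {u v} → Adj G u v → ¬ ProperDistinguishing 1
  edge⇒¬ProperDistinguishing₁ {u} {v} a (g , proper , _) =
    proper u v a (trans (n<1⇒n≡0 (Fin.toℕ<n (lookup g u))) (sym (n<1⇒n≡0 (Fin.toℕ<n (lookup g v)))))

two-colors : ∀ {a b c : Fin 2} → a ≢ b → b ≢ c → a ≡ c
two-colors {0F} {0F}            a≢b _   = ⊥-elim (a≢b refl)
two-colors {0F} {1F} {0F}       _   _   = refl
two-colors {0F} {1F} {1F}       _   b≢c = ⊥-elim (b≢c refl)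
two-colors {1F} {0F} {0F}       _   b≢c = ⊥-elim (b≢c refl)
two-colors {1F} {0F} {1F}       _   _   = refl
two-colors {1F} {1F}            a≢b _   = ⊥-elim (a≢b refl)

all-vectors? : ∀ {k m} {P : Vec (Fin k) m → Set} → (∀ xs → Dec (P xs)) → Dec (∀ xs → P xs)
all-vectors? {m = zero}  P? = map′ (λ p → λ { Vec.[] → p }) (λ h → h Vec.[]) (P? Vec.[])
all-vectors? {m = suc m} P? = map′ (λ h → λ { (x Vec.∷ xs) → h x xs }) (λ h x xs → h (x Vec.∷ xs))
  (Fin.all? (λ x → all-vectors? (λ xs → P? (x Vec.∷ xs))))

-- Automorphisms

module _ {G : Graph} where

  automorphism-∘ : ∀ {π ρ} → IsAutomorphism G π → IsAutomorphism G ρ → IsAutomorphism G (π ∘ₚ ρ)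
  automorphism-∘ π-aut ρ-aut u v =
    (λ a → proj₁ (ρ-aut _ _) (proj₁ (π-aut u v) a)) , (λ a → proj₂ (π-aut u v) (proj₂ (ρ-aut _ _) a))

  automorphism-inverse : ∀ {π} → IsAutomorphism G π → IsAutomorphism G (flip π)
  automorphism-inverse {π} π-aut u v =
    (λ a → proj₂ (π-aut _ _) (subst₂ (Adj G) (sym (inverseʳ π)) (sym (inverseʳ π)) a)) ,
    (λ a → subst₂ (Adj G) (inverseʳ π) (inverseʳ π) (proj₁ (π-aut _ _) a))

  involution-automorphism : (π : Permutation′ (n G)) → (∀ x → π ⟨$⟩ʳ (π ⟨$⟩ʳ x) ≡ x) →
    (∀ u v → Adj G u v → Adj G (π ⟨$⟩ʳ u) (π ⟨$⟩ʳ v)) → IsAutomorphism G π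
  involution-automorphism π π² preserves u v =
    preserves u v , λ a → subst₂ (Adj G) (π² u) (π² v) (preserves _ _ a)

  relabel : ∀ {k} → Permutation′ (n G) → ListAssignment G k → ListAssignment G k
  relabel σ (L , L-injective) = (λ v → L (σ ⟨$⟩ʳ v)) , (λ v → L-injective (σ ⟨$⟩ʳ v))

  ProperlyLDistinguishable-relabel : ∀ {k} (σ : Permutation′ (n G)) → IsAutomorphism G σ →
    (L : ListAssignment G k) → ProperlyLDistinguishable G (relabel σ L) → ProperlyLDistinguishable G L
  ProperlyLDistinguishable-relabel σ σ-aut L (f , proper , distinguishing , respects) =
    f ∘ (σ ⟨$⟩ˡ_) , proper′ , distinguishing′ , respects′
    where
    proper′ : IsProper G (f ∘ (σ ⟨$⟩ˡ_))
    proper′ u v a = proper _ _ (proj₁ (automorphism-inverse {σ} σ-aut u v) a)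

    distinguishing′ : IsDistinguishing G (f ∘ (σ ⟨$⟩ˡ_))
    distinguishing′ φ φ-aut preserves v = begin
      φ ⟨$⟩ʳ v                                    ≡⟨ cong (φ ⟨$⟩ʳ_) (inverseʳ σ) ⟨
      φ ⟨$⟩ʳ (σ ⟨$⟩ʳ (σ ⟨$⟩ˡ v))                   ≡⟨ inverseʳ σ ⟨
      σ ⟨$⟩ʳ (σ ⟨$⟩ˡ (φ ⟨$⟩ʳ (σ ⟨$⟩ʳ (σ ⟨$⟩ˡ v)))) ≡⟨ cong (σ ⟨$⟩ʳ_) (conjugate-fixes (σ ⟨$⟩ˡ v)) ⟩
      σ ⟨$⟩ʳ (σ ⟨$⟩ˡ v)                           ≡⟨ inverseʳ σ ⟩
      v                                         ∎
      where
      open ≡-Reasoning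
      conjugate-fixes : ∀ x → (σ ∘ₚ φ ∘ₚ flip σ) ⟨$⟩ʳ x ≡ x
      conjugate-fixes = distinguishing (σ ∘ₚ φ ∘ₚ flip σ)
        (automorphism-∘ {σ} {φ ∘ₚ flip σ} σ-aut
          (automorphism-∘ {φ} {flip σ} φ-aut (automorphism-inverse {σ} σ-aut)))
        (λ x → trans (preserves (σ ⟨$⟩ʳ x)) (cong f (inverseˡ σ)))

    respects′ : RespectsLists G L (f ∘ (σ ⟨$⟩ˡ_))
    respects′ v = subst (λ w → f (σ ⟨$⟩ˡ v) ∈ₗ proj₁ L w) (inverseʳ σ) (respects (σ ⟨$⟩ˡ v))

  automorphism-along-walks : ∀ {φ} → IsAutomorphism G φ → (len : ℕ) (w w′ : ℕ → Fin (n G)) →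
    (∀ k → k < len → Adj G (w k) (w (suc k))) →
    (∀ k → suc k < len → w (suc (suc k)) ≢ w k) →
    (∀ k y → suc k < len → Adj G (w′ (suc k)) y → y ≡ w′ k ⊎ y ≡ w′ (suc (suc k))) →
    φ ⟨$⟩ʳ w 0 ≡ w′ 0 → φ ⟨$⟩ʳ w 1 ≡ w′ 1 → ∀ k → k ≤ len → φ ⟨$⟩ʳ w k ≡ w′ k
  automorphism-along-walks {φ} φ-aut len w w′ walk no-backtrack continues e₀ e₁ = along
    where
    consecutive : ∀ k → suc k ≤ len → φ ⟨$⟩ʳ w k ≡ w′ k × φ ⟨$⟩ʳ w (suc k) ≡ w′ (suc k)
    consecutive zero    _       = e₀ , e₁
    consecutive (suc k) 2+k≤len with e , e′ ← consecutive k (≤-trans (n≤1+n _) 2+k≤len)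
      with continues k _ 2+k≤len (subst (λ x → Adj G x _) e′ (proj₁ (φ-aut _ _) (walk (suc k) 2+k≤len)))
    ... | inj₁ back  = ⊥-elim (no-backtrack k 2+k≤len (Injection.injective (↔⇒↣ φ) (trans back (sym e))))
    ... | inj₂ forth = e′ , forth

    along : ∀ k → k ≤ len → φ ⟨$⟩ʳ w k ≡ w′ k
    along zero    _       = e₀
    along (suc k) 1+k≤len = proj₂ (consecutive k 1+k≤len)

-- The cyclic order on Fin (suc M)

module CyclicOrder (M : ℕ) where

  N : ℕ
  N = suc M

  open import Function.Endo.Propositional (Fin N) public using (_^_; ^-homo)

  vertex : ℕ → Fin N
  vertex k = k mod N

  toℕ-vertex : ∀ k → toℕ (vertex k) ≡ k % N
  toℕ-vertex k = Fin.toℕ-fromℕ< (m%n<n k N)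

  toℕ-vertex-≤ : ∀ {k} → k ≤ M → toℕ (vertex k) ≡ k
  toℕ-vertex-≤ {k} k≤M = trans (toℕ-vertex k) (m≤n⇒m%n≡m k≤M)

  vertex-toℕ : ∀ v → vertex (toℕ v) ≡ v
  vertex-toℕ v = Fin.toℕ-injective (toℕ-vertex-≤ (Fin.toℕ≤pred[n] v))

  ≡vertex : ∀ {v k} → toℕ v ≡ k → v ≡ vertex k
  ≡vertex {v} e = trans (sym (vertex-toℕ v)) (cong vertex e)

  vertex-2+≢ : ∀ {k} → suc (suc k) ≤ M → vertex (suc (suc k)) ≢ vertex k
  vertex-2+≢ {k} 2+k≤M eq = <-irrefl (begin
    k                    ≡⟨ toℕ-vertex-≤ (≤-trans (n≤1+n k) (≤-trans (n≤1+n _) 2+k≤M)) ⟨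
    toℕ (vertex k)       ≡⟨ cong toℕ eq ⟨
    toℕ (vertex (2 + k)) ≡⟨ toℕ-vertex-≤ 2+k≤M ⟩
    2 + k                ∎) (s≤s (n≤1+n k))
    where open ≡-Reasoning

  vertex-% : ∀ j k → j % N ≡ k % N → vertex j ≡ vertex k
  vertex-% j k eq = Fin.toℕ-injective (trans (toℕ-vertex j) (trans eq (sym (toℕ-vertex k))))

  vertex-+-% : ∀ j k → vertex (j + k % N) ≡ vertex (j + k)
  vertex-+-% j k = vertex-% (j + k % N) (j + k) (begin
    (j + k % N) % N         ≡⟨ %-distribˡ-+ j (k % N) N ⟩
    (j % N + k % N % N) % N ≡⟨ cong (λ x → (j % N + x) % N) (m%n%n≡m%n k N) ⟩
    (j % N + k % N) % N     ≡⟨ %-distribˡ-+ j k N ⟨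
    (j + k) % N             ∎)
    where open ≡-Reasoning

  vertex-N+ : ∀ k → vertex (N + k) ≡ vertex k
  vertex-N+ k = vertex-% (N + k) k (trans (cong (_% N) (+-comm N k)) ([m+n]%n≡m%n k N))

  vertex-N : vertex N ≡ vertex 0
  vertex-N = trans (cong vertex (sym (+-identityʳ N))) (vertex-N+ 0)

  respects-along : ∀ {k} (ℓ : Fin N → Fin k → ℕ) (F : ℕ → ℕ) →
    (∀ j → j ≤ M → F j ∈ₗ ℓ (vertex j)) → ∀ v → F (toℕ v) ∈ₗ ℓ v
  respects-along ℓ F F∈ v =
    subst (λ x → F (toℕ v) ∈ₗ ℓ x) (vertex-toℕ v) (F∈ (toℕ v) (Fin.toℕ≤pred[n] v))

  s p : Fin N → Fin N
  s v = vertex (suc (toℕ v))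
  p v = vertex (M + toℕ v)

  s-vertex : ∀ k → s (vertex k) ≡ vertex (suc k)
  s-vertex k = trans (cong (vertex ∘ suc) (toℕ-vertex k)) (vertex-+-% 1 k)

  p-s : ∀ v → p (s v) ≡ v
  p-s v = begin
    vertex (M + toℕ (vertex (suc (toℕ v)))) ≡⟨ cong (vertex ∘ (M +_)) (toℕ-vertex (suc (toℕ v))) ⟩
    vertex (M + suc (toℕ v) % N)            ≡⟨ vertex-+-% M (suc (toℕ v)) ⟩
    vertex (M + suc (toℕ v))                ≡⟨ cong vertex (+-suc M (toℕ v)) ⟩
    vertex (N + toℕ v)                      ≡⟨ vertex-N+ (toℕ v) ⟩
    vertex (toℕ v)                          ≡⟨ vertex-toℕ v ⟩
    v                                       ∎
    where open ≡-Reasoning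

  s-p : ∀ v → s (p v) ≡ v
  s-p v = trans (s-vertex (M + toℕ v)) (trans (vertex-N+ (toℕ v)) (vertex-toℕ v))

  p-vertex : ∀ k → p (vertex (suc k)) ≡ vertex k
  p-vertex k = trans (cong p (sym (s-vertex k))) (p-s (vertex k))

  p-vertex-0 : p (vertex 0) ≡ vertex M
  p-vertex-0 = cong vertex (+-identityʳ M)

  s-cases : ∀ v → (toℕ v < M × toℕ (s v) ≡ suc (toℕ v)) ⊎ (toℕ v ≡ M × toℕ (s v) ≡ 0)
  s-cases v with m≤n⇒m<n∨m≡n (Fin.toℕ≤pred[n] v)
  ... | inj₁ v<M = inj₁ (v<M , toℕ-vertex-≤ v<M)
  ... | inj₂ v≡M = inj₂ (v≡M , trans (toℕ-vertex (suc (toℕ v))) (trans (cong (λ x → suc x % N) v≡M) (n%n≡0 N)))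

  ^-suc : ∀ (f : Fin N → Fin N) r x → (f ^ suc r) x ≡ (f ^ r) (f x)
  ^-suc f r x = trans (cong (λ k → (f ^ k) x) (+-comm 1 r)) (cong (λ g → g x) (^-homo f r 1))

  ^-inverse : ∀ (f g : Fin N → Fin N) → (∀ x → f (g x) ≡ x) → ∀ r x → (f ^ r) ((g ^ r) x) ≡ x
  ^-inverse f g fg zero    x = refl
  ^-inverse f g fg (suc r) x = begin
    (f ^ suc r) (g ((g ^ r) x)) ≡⟨ ^-suc f r _ ⟩
    (f ^ r) (f (g ((g ^ r) x))) ≡⟨ cong (f ^ r) (fg _) ⟩
    (f ^ r) ((g ^ r) x)         ≡⟨ ^-inverse f g fg r x ⟩
    x                           ∎
    where open ≡-Reasoning

  s^-vertex : ∀ r k → (s ^ r) (vertex k) ≡ vertex (r + k)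
  s^-vertex zero    k = refl
  s^-vertex (suc r) k = trans (cong s (s^-vertex r k)) (s-vertex (r + k))

  p^-vertex : ∀ i k → i ≤ k → (p ^ i) (vertex k) ≡ vertex (k ∸ i)
  p^-vertex zero    k _   = refl
  p^-vertex (suc i) k i<k = begin
    p ((p ^ i) (vertex k))       ≡⟨ cong p (p^-vertex i k (<⇒≤ i<k)) ⟩
    p (vertex (k ∸ i))           ≡⟨ cong (p ∘ vertex) (+-∸-assoc 1 i<k) ⟩
    p (vertex (suc (k ∸ suc i))) ≡⟨ p-vertex (k ∸ suc i) ⟩
    vertex (k ∸ suc i)           ∎
    where open ≡-Reasoning

  toℕ-opposite : ∀ (v : Fin N) → toℕ (opposite v) ≡ M ∸ toℕ v
  toℕ-opposite = Fin.opposite-prop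

  opposite-suc : ∀ {u v : Fin N} → toℕ v ≡ suc (toℕ u) → toℕ (opposite u) ≡ suc (toℕ (opposite v))
  opposite-suc {u} {v} v≡1+u = begin
    toℕ (opposite u)       ≡⟨ toℕ-opposite u ⟩
    M ∸ toℕ u              ≡⟨ +-∸-assoc 1 u<M ⟩
    suc (M ∸ suc (toℕ u))  ≡⟨ cong (λ x → suc (M ∸ x)) v≡1+u ⟨
    suc (M ∸ toℕ v)        ≡⟨ cong suc (toℕ-opposite v) ⟨
    suc (toℕ (opposite v)) ∎
    where
    open ≡-Reasoning
    u<M : toℕ u < M
    u<M = subst (_≤ M) v≡1+u (Fin.toℕ≤pred[n] v)

-- Cycles

module CycleGraph (M : ℕ) where

  open CyclicOrder M

  C : Graph
  C = Cycle N

  adj-s : ∀ v → Adj C v (s v)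
  adj-s v = inj₁ (toℕ-vertex (suc (toℕ v)))

  adj⇒s : ∀ {u v} → Adj C u v → v ≡ s u ⊎ u ≡ s v
  adj⇒s {u}     (inj₁ e) = inj₁ (Fin.toℕ-injective (trans e (sym (toℕ-vertex (suc (toℕ u))))))
  adj⇒s {v = v} (inj₂ e) = inj₂ (Fin.toℕ-injective (trans e (sym (toℕ-vertex (suc (toℕ v))))))

  s⇒adj : ∀ {u v} → v ≡ s u ⊎ u ≡ s v → Adj C u v
  s⇒adj {u}     (inj₁ refl) = adj-s u
  s⇒adj {v = v} (inj₂ refl) = inj₂ (toℕ-vertex (suc (toℕ v)))

  neighbours : ∀ {u v} → Adj C u v → v ≡ s u ⊎ v ≡ p u
  neighbours a with adj⇒s a
  ... | inj₁ e = inj₁ e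
  ... | inj₂ e = inj₂ (trans (sym (p-s _)) (cong p (sym e)))

  adj-vertex : ∀ k → Adj C (vertex k) (vertex (suc k))
  adj-vertex k = subst (Adj C (vertex k)) (s-vertex k) (adj-s (vertex k))

  rotation : ℕ → Permutation′ N
  rotation r = permutation (s ^ r) (p ^ r) (^-inverse s p s-p r) (^-inverse p s p-s r)

  rotation-automorphism : ∀ r → IsAutomorphism C (rotation r)
  rotation-automorphism r u v = forward , backward
    where
    commute : ∀ x → (s ^ r) (s x) ≡ s ((s ^ r) x)
    commute x = sym (^-suc s r x)

    injective : ∀ {x y} → (s ^ r) x ≡ (s ^ r) y → x ≡ y
    injective {x} {y} e = trans (sym (^-inverse p s p-s r x)) (trans (cong (p ^ r) e) (^-inverse p s p-s r y))

    forward : Adj C u v → Adj C ((s ^ r) u) ((s ^ r) v)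
    forward a with adj⇒s a
    ... | inj₁ refl = s⇒adj (inj₁ (commute u))
    ... | inj₂ refl = s⇒adj (inj₂ (commute v))

    backward : Adj C ((s ^ r) u) ((s ^ r) v) → Adj C u v
    backward a with adj⇒s a
    ... | inj₁ e = s⇒adj (inj₁ (injective (trans e (sym (commute u)))))
    ... | inj₂ e = s⇒adj (inj₂ (injective (trans e (sym (commute v)))))

  s-opposite-s : ∀ x → s (opposite (s x)) ≡ opposite x
  s-opposite-s x with s-cases x
  ... | inj₁ (_ , sx≡1+x) = trans (cong vertex (sym (opposite-suc sx≡1+x))) (vertex-toℕ (opposite x))
  ... | inj₂ (x≡M , sx≡0) = Fin.toℕ-injective (begin
    toℕ (s (opposite (s x)))       ≡⟨ toℕ-vertex (suc (toℕ (opposite (s x)))) ⟩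
    suc (toℕ (opposite (s x))) % N ≡⟨ cong (λ y → suc y % N) (toℕ-opposite (s x)) ⟩
    suc (M ∸ toℕ (s x)) % N        ≡⟨ cong (λ y → suc (M ∸ y) % N) sx≡0 ⟩
    N % N                          ≡⟨ n%n≡0 N ⟩
    0                              ≡⟨ n∸n≡0 M ⟨
    M ∸ M                          ≡⟨ cong (M ∸_) x≡M ⟨
    M ∸ toℕ x                      ≡⟨ toℕ-opposite x ⟨
    toℕ (opposite x)               ∎)
    where open ≡-Reasoning

  reflection-automorphism : IsAutomorphism C reverse
  reflection-automorphism = involution-automorphism reverse Fin.opposite-involutive preserves
    where
    preserves : ∀ u v → Adj C u v → Adj C (opposite u) (opposite v)
    preserves u v a with adj⇒s a
    ... | inj₁ refl = s⇒adj (inj₂ (sym (s-opposite-s u)))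
    ... | inj₂ refl = s⇒adj (inj₁ (sym (s-opposite-s v)))

  s-colors-differ : (F : ℕ → ℕ) → (∀ k → k < M → F k ≢ F (suc k)) → F M ≢ F 0 →
    ∀ u → F (toℕ u) ≢ F (toℕ (s u))
  s-colors-differ F step wrap u with s-cases u
  ... | inj₁ (u<M , su≡1+u) = λ e → step (toℕ u) u<M (trans e (cong F su≡1+u))
  ... | inj₂ (u≡M , su≡0)   = λ e → wrap (trans (cong F (sym u≡M)) (trans e (cong F su≡0)))

  cycle-proper : (F : ℕ → ℕ) → (∀ k → k < M → F k ≢ F (suc k)) → F M ≢ F 0 → IsProper C (F ∘ toℕ)
  cycle-proper F step wrap u v a with adj⇒s a
  ... | inj₁ refl = s-colors-differ F step wrap u
  ... | inj₂ refl = s-colors-differ F step wrap v ∘ sym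

  NoSymmetryTo : (Fin N → ℕ) → Fin N → Set
  NoSymmetryTo f w = (w ≢ vertex 0 → ∃ λ i → i ≤ M × f ((s ^ i) w) ≢ f (vertex i))
                   × (∃ λ i → i ≤ M × f ((p ^ i) w) ≢ f (vertex i))

  module _ (2≤M : 2 ≤ M) where

    cycle-automorphism : ∀ {φ} → IsAutomorphism C φ →
      (∀ k → k ≤ M → φ ⟨$⟩ʳ vertex k ≡ (s ^ k) (φ ⟨$⟩ʳ vertex 0)) ⊎
      (∀ k → k ≤ M → φ ⟨$⟩ʳ vertex k ≡ (p ^ k) (φ ⟨$⟩ʳ vertex 0))
    cycle-automorphism {φ} φ-aut with neighbours (proj₁ (φ-aut (vertex 0) (vertex 1)) (adj-s (vertex 0)))
    ... | inj₁ e = inj₁ (automorphism-along-walks {C} {φ} φ-aut M vertex (λ k → (s ^ k) w)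
                           (λ k _ → adj-vertex k) (λ _ → vertex-2+≢) s-continues refl e)
      where
      w = φ ⟨$⟩ʳ vertex 0
      s-continues : ∀ k y → suc k < M → Adj C ((s ^ suc k) w) y → y ≡ (s ^ k) w ⊎ y ≡ (s ^ suc (suc k)) w
      s-continues k y _ a with neighbours a
      ... | inj₁ e = inj₂ e
      ... | inj₂ e = inj₁ (trans e (p-s _))
    ... | inj₂ e = inj₂ (automorphism-along-walks {C} {φ} φ-aut M vertex (λ k → (p ^ k) w)
                           (λ k _ → adj-vertex k) (λ _ → vertex-2+≢) p-continues refl e)
      where
      w = φ ⟨$⟩ʳ vertex 0
      p-continues : ∀ k y → suc k < M → Adj C ((p ^ suc k) w) y → y ≡ (p ^ k) w ⊎ y ≡ (p ^ suc (suc k)) w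
      p-continues k y _ a with neighbours a
      ... | inj₁ e = inj₁ (trans e (s-p _))
      ... | inj₂ e = inj₂ e

    cycle-distinguishing : (f : Fin N → ℕ) → (∀ w → f w ≡ f (vertex 0) → NoSymmetryTo f w) →
      IsDistinguishing C f
    cycle-distinguishing f asymmetric φ φ-aut preserves v
      with cycle-automorphism {φ} φ-aut | asymmetric (φ ⟨$⟩ʳ vertex 0) (preserves (vertex 0))
    ... | inj₂ reflected | _ , (i , i≤M , differ) =
      ⊥-elim (differ (trans (cong f (sym (reflected i i≤M))) (preserves (vertex i))))
    ... | inj₁ rotated | moved , _ with φ ⟨$⟩ʳ vertex 0 Fin.≟ vertex 0
    ...   | no w≢0 with i , i≤M , differ ← moved w≢0 =
      ⊥-elim (differ (trans (cong f (sym (rotated i i≤M))) (preserves (vertex i))))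
    ...   | yes w≡0 = begin
      φ ⟨$⟩ʳ v                      ≡⟨ cong (φ ⟨$⟩ʳ_) (vertex-toℕ v) ⟨
      φ ⟨$⟩ʳ vertex (toℕ v)         ≡⟨ rotated (toℕ v) (Fin.toℕ≤pred[n] v) ⟩
      (s ^ toℕ v) (φ ⟨$⟩ʳ vertex 0) ≡⟨ cong (s ^ toℕ v) w≡0 ⟩
      (s ^ toℕ v) (vertex 0)        ≡⟨ s^-vertex (toℕ v) 0 ⟩
      vertex (toℕ v + 0)            ≡⟨ cong vertex (+-identityʳ (toℕ v)) ⟩
      vertex (toℕ v)                ≡⟨ vertex-toℕ v ⟩
      v                             ∎
      where open ≡-Reasoning

    unique-start-distinguishing : (F : ℕ → ℕ) → (∀ k → k ≤ M → F k ≡ F 0 → k ≡ 0) → F 1 ≢ F M →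
      IsDistinguishing C (F ∘ toℕ)
    unique-start-distinguishing F unique F1≢FM = cycle-distinguishing (F ∘ toℕ) asymmetric
      where
      1≤M = ≤-trans (n≤1+n 1) 2≤M

      reflection-moves : F (toℕ (p (vertex 0))) ≢ F (toℕ (vertex 1))
      reflection-moves e = F1≢FM (begin
        F 1                      ≡⟨ cong F (toℕ-vertex-≤ 1≤M) ⟨
        F (toℕ (vertex 1))       ≡⟨ e ⟨
        F (toℕ (p (vertex 0)))   ≡⟨ cong (F ∘ toℕ) p-vertex-0 ⟩
        F (toℕ (vertex M))       ≡⟨ cong F (toℕ-vertex-≤ ≤-refl) ⟩
        F M                      ∎)
        where open ≡-Reasoning

      asymmetric : ∀ w → F (toℕ w) ≡ F 0 → NoSymmetryTo (F ∘ toℕ) w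
      asymmetric w same = subst (NoSymmetryTo (F ∘ toℕ)) (sym w≡0)
        ((λ 0≢0 → ⊥-elim (0≢0 refl)) , (1 , 1≤M , reflection-moves))
        where
        w≡0 : w ≡ vertex 0
        w≡0 = Fin.toℕ-injective (unique (toℕ w) (Fin.toℕ≤pred[n] w) same)

    cycle-¬ProperDistinguishing₂ : ¬ ProperDistinguishing {C} 2
    cycle-¬ProperDistinguishing₂ (g , proper , distinguishing) =
      vertex-2+≢ 2≤M (trans (sym (s^-vertex 2 0))
        (distinguishing (rotation 2) (rotation-automorphism 2) two-periodic (vertex 0)))
      where
      differ : ∀ v → lookup g v ≢ lookup g (s v)
      differ v = proper v (s v) (adj-s v) ∘ cong toℕ
      two-periodic : ∀ v → toℕ (lookup g (s (s v))) ≡ toℕ (lookup g v)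
      two-periodic v = cong toℕ (sym (two-colors (differ v) (differ (s v))))

-- Colorings of cycles

alternating : ℕ → Fin 3
alternating zero          = 0F
alternating (suc zero)    = 1F
alternating (suc (suc k)) = alternating k

alternating-step : ∀ k → alternating k ≢ alternating (suc k)
alternating-step zero          ()
alternating-step (suc zero)    ()
alternating-step (suc (suc k)) = alternating-step k

alternating≢2 : ∀ k → alternating k ≢ 2F
alternating≢2 zero          ()
alternating≢2 (suc zero)    ()
alternating≢2 (suc (suc k)) = alternating≢2 k

-- Color 2 marks exactly the vertices 0 and 3; their distances 3 and N − 3 along the two arcs
-- of a cycle differ unless N = 6.
colorPattern : ℕ → Fin 3
colorPattern 0 = 2F
colorPattern 1 = 0F
colorPattern 2 = 1F
colorPattern 3 = 2F
colorPattern k@(suc (suc (suc (suc _)))) = alternating k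

colorPattern-step : ∀ k → colorPattern k ≢ colorPattern (suc k)
colorPattern-step 0 ()
colorPattern-step 1 ()
colorPattern-step 2 ()
colorPattern-step 3 ()
colorPattern-step (suc (suc (suc (suc k)))) = alternating-step k

colorPattern-2 : ∀ k → colorPattern k ≡ 2F → k ≡ 0 ⊎ k ≡ 3
colorPattern-2 0 _ = inj₁ refl
colorPattern-2 3 _ = inj₂ refl
colorPattern-2 (suc (suc (suc (suc k)))) e = ⊥-elim (alternating≢2 k e)

module CycleColorings (M : ℕ) (2≤M : 2 ≤ M) where

  open CyclicOrder M
  open CycleGraph M

  module StartingWith {k} (3≤k : 3 ≤ k) (L : ListAssignment C k) (a : ℕ) where

    open Greedy (λ j → proj₁ L (vertex (2 + j))) (λ j → proj₂ L (vertex (2 + j))) (a ∷ []) 3≤k public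

    coloring : ℕ → ℕ → ℕ
    coloring b zero          = a
    coloring b (suc zero)    = b
    coloring b (suc (suc j)) = color j

    coloring-≥2 : ∀ b m → 2 ≤ m → coloring b m ≡ color (m ∸ 2)
    coloring-≥2 b (suc zero)    (s≤s ())
    coloring-≥2 b (suc (suc m)) _ = refl

    properly-distinguishes : ∀ {b} → a ∈ₗ proj₁ L (vertex 0) → b ∈ₗ proj₁ L (vertex 1) →
      b ≢ a → b ≢ color 0 → b ≢ color (M ∸ 2) → ProperlyLDistinguishable C L
    properly-distinguishes {b} a∈ b∈ b≢a b≢first b≢last =
      F ∘ toℕ , cycle-proper F step wrap , unique-start-distinguishing 2≤M F unique (b≢last ∘ F-last) ,
      respects-along (proj₁ L) F F∈
      where
      F = coloring b

      F-last : b ≡ F M → b ≡ color (M ∸ 2)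
      F-last e = trans e (coloring-≥2 b M 2≤M)

      step : ∀ j → j < M → F j ≢ F (suc j)
      step zero          _ = b≢a ∘ sym
      step (suc zero)    _ = b≢first
      step (suc (suc j)) _ = color-step j ∘ sym

      wrap : F M ≢ F 0
      wrap = color-∉-reserved (M ∸ 2) ∘ here ∘ trans (sym (coloring-≥2 b M 2≤M))

      unique : ∀ j → j ≤ M → F j ≡ F 0 → j ≡ 0
      unique zero          _ _ = refl
      unique (suc zero)    _ e = ⊥-elim (b≢a e)
      unique (suc (suc j)) _ e = ⊥-elim (color-∉-reserved j (here e))

      F∈ : ∀ j → j ≤ M → F j ∈ₗ proj₁ L (vertex j)
      F∈ zero          _ = a∈
      F∈ (suc zero)    _ = b∈
      F∈ (suc (suc j)) _ = color-∈ j

  four-lists : ListDistinguishableWith C 4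
  four-lists L =
    properly-distinguishes (0F , refl) b∈ (b∉ ∘ here) (b∉ ∘ there ∘ here) (b∉ ∘ there ∘ there ∘ here)
    where
    a = proj₁ L (vertex 0) 0F
    open StartingWith (n≤1+n 3) L a
    b-choice = fresh (proj₁ L (vertex 1)) (proj₂ L (vertex 1)) (a ∷ color 0 ∷ color (M ∸ 2) ∷ []) ≤-refl
    b∈ = proj₁ (proj₂ b-choice)
    b∉ = proj₂ (proj₂ b-choice)

  Identical : ListAssignment C 3 → Set
  Identical L = ∀ v → proj₁ L (vertex 0) ⊆ₗ proj₁ L v

  -- Either some color a of a list L v is missing from L (s v), and after rotating v to vertex 0
  -- the color a can be used at vertex 0 alone; or each list is contained in the next one.
  three-lists : ((L : ListAssignment C 3) → Identical L → ProperlyLDistinguishable C L) →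
    ListDistinguishableWith C 3
  three-lists identical-case L with Fin.any? (λ v → Fin.any? (λ i → ¬? (proj₁ L v i ∈ₗ? proj₁ L (s v))))
  ... | no ∄ = identical-case L identical
    where
    ⊆-s : ∀ v → proj₁ L v ⊆ₗ proj₁ L (s v)
    ⊆-s v i = decidable-stable (proj₁ L v i ∈ₗ? proj₁ L (s v)) (λ ∉ → ∄ (v , i , ∉))

    ⊆-vertex : ∀ k → proj₁ L (vertex 0) ⊆ₗ proj₁ L (vertex k)
    ⊆-vertex zero    i = i , refl
    ⊆-vertex (suc k) i = subst (λ x → _ ∈ₗ proj₁ L x) (s-vertex k) (∈ₗ-⊆ₗ (⊆-vertex k i) (⊆-s (vertex k)))

    identical : Identical L
    identical v = subst (λ x → proj₁ L (vertex 0) ⊆ₗ proj₁ L x) (vertex-toℕ v) (⊆-vertex (toℕ v))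
  ... | yes (v , i , a∉next) =
    ProperlyLDistinguishable-relabel σ (rotation-automorphism (toℕ v)) L
      (properly-distinguishes a∈ b∈ b≢a (b∉ ∘ here) (b∉ ∘ there ∘ here))
    where
    σ = rotation (toℕ v)
    a = proj₁ L v i
    L′ = relabel {C} σ L

    σ0 : (s ^ toℕ v) (vertex 0) ≡ v
    σ0 = trans (s^-vertex (toℕ v) 0) (trans (cong vertex (+-identityʳ (toℕ v))) (vertex-toℕ v))

    σ1 : (s ^ toℕ v) (vertex 1) ≡ s v
    σ1 = trans (sym (^-suc s (toℕ v) (vertex 0))) (cong s σ0)

    open StartingWith ≤-refl L′ a

    a∈ : a ∈ₗ proj₁ L′ (vertex 0)
    a∈ = subst (λ x → a ∈ₗ proj₁ L x) (sym σ0) (i , refl)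

    b-choice = fresh (proj₁ L′ (vertex 1)) (proj₂ L′ (vertex 1)) (color 0 ∷ color (M ∸ 2) ∷ []) ≤-refl
    b∈ = proj₁ (proj₂ b-choice)
    b∉ = proj₂ (proj₂ b-choice)

    b≢a : proj₁ b-choice ≢ a
    b≢a b≡a = a∉next (subst (λ x → a ∈ₗ proj₁ L x) σ1 (proj₁ b∈ , trans (proj₂ b∈) b≡a))

  module PatternColoring (4≤M : 4 ≤ M) (M≢5 : M ≢ 5) (c : Fin 3 → ℕ) (c-injective : Injective _≡_ _≡_ c) where

    2<M : 2 < M
    2<M = ≤-trans (n≤1+n 3) 4≤M

    1≤M : 1 ≤ M
    1≤M = ≤-trans (s≤s z≤n) 2<M

    F : ℕ → ℕ
    F = c ∘ colorPattern

    F-vertex : ∀ {k} → k ≤ M → F (toℕ (vertex k)) ≡ F k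
    F-vertex = cong F ∘ toℕ-vertex-≤

    F-M : F M ≢ F 0
    F-M e with colorPattern-2 M (c-injective e)
    ... | inj₁ M≡0 = m<n⇒n≢0 2<M M≡0
    ... | inj₂ M≡3 = <⇒≢ 4≤M (sym M≡3)

    F-M∸2 : F (M ∸ 2) ≢ F 3
    F-M∸2 e with colorPattern-2 (M ∸ 2) (c-injective e)
    ... | inj₁ M∸2≡0 = ≤⇒≯ (m∸n≡0⇒m≤n M∸2≡0) 2<M
    ... | inj₂ M∸2≡3 = M≢5 (trans (sym (m∸n+n≡m (<⇒≤ 2<M))) (cong (_+ 2) M∸2≡3))

    no-symmetry-to-0 : NoSymmetryTo (F ∘ toℕ) (vertex 0)
    no-symmetry-to-0 = (λ 0≢0 → ⊥-elim (0≢0 refl)) , (3 , <⇒≤ 4≤M , λ e → F-M∸2 (begin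
      F (M ∸ 2)                        ≡⟨ F-vertex (m∸n≤m M 2) ⟨
      F (toℕ (vertex (M ∸ 2)))         ≡⟨ cong (F ∘ toℕ) (p^-vertex 2 M (<⇒≤ 2<M)) ⟨
      F (toℕ ((p ^ 2) (vertex M)))     ≡⟨ cong (F ∘ toℕ ∘ (p ^ 2)) p-vertex-0 ⟨
      F (toℕ ((p ^ 2) (p (vertex 0)))) ≡⟨ cong (F ∘ toℕ) (^-suc p 2 (vertex 0)) ⟨
      F (toℕ ((p ^ 3) (vertex 0)))     ≡⟨ e ⟩
      F (toℕ (vertex 3))               ≡⟨ F-vertex (<⇒≤ 4≤M) ⟩
      F 3                              ∎))
      where open ≡-Reasoning

    no-symmetry-to-3 : NoSymmetryTo (F ∘ toℕ) (vertex 3)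
    no-symmetry-to-3 = (λ _ → M ∸ 2 , m∸n≤m M 2 , rotation-returns) , (1 , 1≤M , reflection-moves)
      where
      open ≡-Reasoning
      M∸2+3≡N : M ∸ 2 + 3 ≡ N
      M∸2+3≡N = trans (+-suc (M ∸ 2) 2) (cong suc (m∸n+n≡m (<⇒≤ 2<M)))

      rotation-returns : F (toℕ ((s ^ (M ∸ 2)) (vertex 3))) ≢ F (toℕ (vertex (M ∸ 2)))
      rotation-returns e = F-M∸2 (sym (begin
        F 3                                ≡⟨ cong (F ∘ toℕ) vertex-N ⟨
        F (toℕ (vertex N))                 ≡⟨ cong (F ∘ toℕ ∘ vertex) M∸2+3≡N ⟨
        F (toℕ (vertex (M ∸ 2 + 3)))       ≡⟨ cong (F ∘ toℕ) (s^-vertex (M ∸ 2) 3) ⟨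
        F (toℕ ((s ^ (M ∸ 2)) (vertex 3))) ≡⟨ e ⟩
        F (toℕ (vertex (M ∸ 2)))           ≡⟨ F-vertex (m∸n≤m M 2) ⟩
        F (M ∸ 2)                          ∎))

      reflection-moves : F (toℕ (p (vertex 3))) ≢ F (toℕ (vertex 1))
      reflection-moves e with c-injective (begin
        F 2                    ≡⟨ F-vertex (<⇒≤ 2<M) ⟨
        F (toℕ (vertex 2))     ≡⟨ cong (F ∘ toℕ) (p-vertex 2) ⟨
        F (toℕ (p (vertex 3))) ≡⟨ e ⟩
        F (toℕ (vertex 1))     ≡⟨ F-vertex 1≤M ⟩
        F 1                    ∎)
      ... | ()

    pattern-proper : IsProper C (F ∘ toℕ)
    pattern-proper = cycle-proper F (λ k _ → colorPattern-step k ∘ c-injective) F-M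

    pattern-distinguishing : IsDistinguishing C (F ∘ toℕ)
    pattern-distinguishing = cycle-distinguishing 2≤M (F ∘ toℕ) λ w same →
      [ (λ w≡0 → subst (NoSymmetryTo (F ∘ toℕ)) (sym (≡vertex w≡0)) no-symmetry-to-0) ,
        (λ w≡3 → subst (NoSymmetryTo (F ∘ toℕ)) (sym (≡vertex w≡3)) no-symmetry-to-3) ]′
      (colorPattern-2 (toℕ w) (c-injective same))

  identical-lists : 4 ≤ M → M ≢ 5 → (L : ListAssignment C 3) → Identical L → ProperlyLDistinguishable C L
  identical-lists 4≤M M≢5 L identical =
    F ∘ toℕ , pattern-proper , pattern-distinguishing ,
    respects-along (proj₁ L) F (λ j _ → identical (vertex j) (colorPattern j))
    where open PatternColoring 4≤M M≢5 (proj₁ L (vertex 0)) (proj₂ L (vertex 0))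

module SmallCycle (M : ℕ) where

  open CyclicOrder M
  open CycleGraph M

  NontrivialSymmetry : (Fin N → Fin 3) → Permutation′ N → Set
  NontrivialSymmetry g σ = (∃ λ v → σ ⟨$⟩ʳ v ≢ v) × (∀ v → g (σ ⟨$⟩ʳ v) ≡ g v)

  Flawed : (Fin N → Fin 3) → Set
  Flawed g = (∃ λ v → g v ≡ g (s v))
           ⊎ (∃ λ (r : Fin N) → NontrivialSymmetry g (rotation (toℕ r)))
           ⊎ (∃ λ (r : Fin N) → NontrivialSymmetry g (rotation (toℕ r) ∘ₚ reverse))

  flawed? : ∀ g → Dec (Flawed g)
  flawed? g = Fin.any? (λ v → g v Fin.≟ g (s v))
        ⊎-dec Fin.any? (λ r → symmetry? (rotation (toℕ r)))
        ⊎-dec Fin.any? (λ r → symmetry? (rotation (toℕ r) ∘ₚ reverse))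
    where
    symmetry? : ∀ σ → Dec (NontrivialSymmetry g σ)
    symmetry? σ = Fin.any? {N} (λ v → ¬? (σ ⟨$⟩ʳ v Fin.≟ v)) ×-dec Fin.all? {N} (λ v → g (σ ⟨$⟩ʳ v) Fin.≟ g v)

  ¬ProperDistinguishing₃ : (∀ xs → Flawed (lookup xs)) → ¬ ProperDistinguishing {C} 3
  ¬ProperDistinguishing₃ flawed (g , proper , distinguishing) with flawed g
  ... | inj₁ (v , same) = proper v (s v) (adj-s v) (cong toℕ same)
  ... | inj₂ (inj₁ (r , (v , moved) , symmetric)) =
    moved (distinguishing (rotation (toℕ r)) (rotation-automorphism (toℕ r)) (cong toℕ ∘ symmetric) v)
  ... | inj₂ (inj₂ (r , (v , moved) , symmetric)) =
    moved (distinguishing (rotation (toℕ r) ∘ₚ reverse)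
      (automorphism-∘ {C} {rotation (toℕ r)} {reverse} (rotation-automorphism (toℕ r)) reflection-automorphism)
      (cong toℕ ∘ symmetric) v)

C₄-¬ProperDistinguishing₃ : ¬ ProperDistinguishing {Cycle 4} 3
C₄-¬ProperDistinguishing₃ = ¬ProperDistinguishing₃ (toWitness {a? = all-vectors? {3} {4} (flawed? ∘ lookup)} tt)
  where open SmallCycle 3

C₆-¬ProperDistinguishing₃ : ¬ ProperDistinguishing {Cycle 6} 3
C₆-¬ProperDistinguishing₃ = ¬ProperDistinguishing₃ (toWitness {a? = all-vectors? {3} {6} (flawed? ∘ lookup)} tt)
  where open SmallCycle 5

-- Paths

module PathGraph (M : ℕ) where

  open CyclicOrder M

  P : Graph
  P = Path N

  adj-vertex : ∀ k → k < M → Adj P (vertex k) (vertex (suc k))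
  adj-vertex k k<M = inj₁ (trans (toℕ-vertex-≤ k<M) (cong suc (sym (toℕ-vertex-≤ (<⇒≤ k<M)))))

  neighbours : ∀ k y → suc k < M → Adj P (vertex (suc k)) y → y ≡ vertex k ⊎ y ≡ vertex (suc (suc k))
  neighbours k y 2+k≤M (inj₁ e) = inj₂ (≡vertex (trans e (cong suc (toℕ-vertex-≤ (<⇒≤ 2+k≤M)))))
  neighbours k y 2+k≤M (inj₂ e) = inj₁ (≡vertex (suc-injective (trans (sym e) (toℕ-vertex-≤ (<⇒≤ 2+k≤M)))))

  neighbour-of-0 : ∀ {y} → Adj P (vertex 0) y → toℕ y ≡ 1
  neighbour-of-0 (inj₁ e) = e

  reversal-automorphism : IsAutomorphism P reverse
  reversal-automorphism = involution-automorphism reverse Fin.opposite-involutive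
    (λ u v → [ inj₂ ∘ opposite-suc , inj₁ ∘ opposite-suc ]′)

  path-proper : (F : ℕ → ℕ) → (∀ k → F (suc k) ≢ F k) → IsProper P (F ∘ toℕ)
  path-proper F step u v (inj₁ e) eq = step (toℕ u) (trans (cong F (sym e)) (sym eq))
  path-proper F step u v (inj₂ e) eq = step (toℕ v) (trans (cong F (sym e)) eq)

  module _ (1≤M : 1 ≤ M) where

    automorphism-fixing-0 : ∀ {φ} → IsAutomorphism P φ → φ ⟨$⟩ʳ vertex 0 ≡ vertex 0 → ∀ v → φ ⟨$⟩ʳ v ≡ v
    automorphism-fixing-0 {φ} φ-aut fixed v = begin
      φ ⟨$⟩ʳ v              ≡⟨ cong (φ ⟨$⟩ʳ_) (vertex-toℕ v) ⟨
      φ ⟨$⟩ʳ vertex (toℕ v) ≡⟨ automorphism-along-walks {P} {φ} φ-aut M vertex vertex adj-vertex (λ _ → vertex-2+≢)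
                                neighbours fixed fixed-1 (toℕ v) (Fin.toℕ≤pred[n] v) ⟩
      vertex (toℕ v)        ≡⟨ vertex-toℕ v ⟩
      v                     ∎
      where
      open ≡-Reasoning
      fixed-1 : φ ⟨$⟩ʳ vertex 1 ≡ vertex 1
      fixed-1 = ≡vertex (neighbour-of-0 (subst (λ x → Adj P x (φ ⟨$⟩ʳ vertex 1)) fixed
        (proj₁ (φ-aut (vertex 0) (vertex 1)) (adj-vertex 0 1≤M))))

    interior-vertex-not-image-of-0 : ∀ {φ} c → IsAutomorphism P φ → toℕ (φ ⟨$⟩ʳ vertex 0) ≡ suc c → suc c < M → ⊥
    interior-vertex-not-image-of-0 {φ} c φ-aut φ0≡1+c 2+c≤M = vertex-2+≢ 2+c≤M (sym below≡above)
      where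
      φ0 = φ ⟨$⟩ʳ vertex 0
      below : Adj P φ0 (vertex c)
      below = inj₂ (trans φ0≡1+c (cong suc (sym (toℕ-vertex-≤ (≤-trans (n≤1+n c) (<⇒≤ 2+c≤M))))))
      above : Adj P φ0 (vertex (suc (suc c)))
      above = inj₁ (trans (toℕ-vertex-≤ 2+c≤M) (cong suc (sym φ0≡1+c)))
      preimage-is-1 : ∀ {y} → Adj P φ0 y → toℕ (φ ⟨$⟩ˡ y) ≡ 1
      preimage-is-1 a = neighbour-of-0 (proj₂ (φ-aut (vertex 0) _) (subst (Adj P φ0) (sym (inverseʳ φ)) a))
      below≡above : vertex c ≡ vertex (suc (suc c))
      below≡above = trans (sym (inverseʳ φ)) (trans
        (cong (φ ⟨$⟩ʳ_) (Fin.toℕ-injective (trans (preimage-is-1 below) (sym (preimage-is-1 above)))))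
        (inverseʳ φ))

    automorphism-at-0 : ∀ {φ} → IsAutomorphism P φ → toℕ (φ ⟨$⟩ʳ vertex 0) ≡ 0 ⊎ toℕ (φ ⟨$⟩ʳ vertex 0) ≡ M
    automorphism-at-0 {φ} φ-aut with toℕ (φ ⟨$⟩ʳ vertex 0) in φ0≡ | Fin.toℕ≤pred[n] (φ ⟨$⟩ʳ vertex 0)
    ... | zero  | _ = inj₁ refl
    ... | suc c | 1+c≤M with m≤n⇒m<n∨m≡n 1+c≤M
    ...   | inj₁ 2+c≤M = ⊥-elim (interior-vertex-not-image-of-0 {φ} c φ-aut φ0≡ 2+c≤M)
    ...   | inj₂ 1+c≡M = inj₂ 1+c≡M

    path-automorphism : ∀ {φ} → IsAutomorphism P φ → (∀ v → φ ⟨$⟩ʳ v ≡ v) ⊎ (∀ v → φ ⟨$⟩ʳ v ≡ opposite v)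
    path-automorphism {φ} φ-aut with automorphism-at-0 {φ} φ-aut
    ... | inj₁ φ0≡0 = inj₁ (automorphism-fixing-0 {φ} φ-aut (Fin.toℕ-injective φ0≡0))
    ... | inj₂ φ0≡M = inj₂ λ v → trans (sym (Fin.opposite-involutive _)) (cong opposite (reversed-fixes v))
      where
      reversed-fixes : ∀ v → opposite (φ ⟨$⟩ʳ v) ≡ v
      reversed-fixes = automorphism-fixing-0 {φ ∘ₚ reverse}
        (automorphism-∘ {P} {φ} {reverse} φ-aut reversal-automorphism)
        (Fin.toℕ-injective (trans (toℕ-opposite (φ ⟨$⟩ʳ vertex 0)) (trans (cong (M ∸_) φ0≡M) (n∸n≡0 M))))

  two-lists-even : ∀ t → M ≡ t + suc t → ListDistinguishableWith P 2
  two-lists-even t M≡ L =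
    color ∘ toℕ , path-proper color color-step , distinguishing , respects-along (proj₁ L) color (λ j _ → color-∈ j)
    where
    open Greedy (proj₁ L ∘ vertex) (proj₂ L ∘ vertex) [] ≤-refl

    t≤M : t ≤ M
    t≤M = subst (t ≤_) (sym M≡) (m≤m+n t (suc t))

    middle-reversed : toℕ (opposite (vertex t)) ≡ suc t
    middle-reversed = begin
      toℕ (opposite (vertex t)) ≡⟨ toℕ-opposite (vertex t) ⟩
      M ∸ toℕ (vertex t)        ≡⟨ cong₂ _∸_ M≡ (toℕ-vertex-≤ t≤M) ⟩
      t + suc t ∸ t             ≡⟨ m+n∸m≡n t (suc t) ⟩
      suc t                     ∎
      where open ≡-Reasoning

    distinguishing : IsDistinguishing P (color ∘ toℕ)
    distinguishing φ φ-aut preserves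
      with path-automorphism (subst (1 ≤_) (sym M≡) (≤-trans (s≤s z≤n) (m≤n+m (suc t) t))) {φ} φ-aut
    ... | inj₁ fixed    = fixed
    ... | inj₂ reversed = ⊥-elim (color-step t (begin
      color (suc t)                     ≡⟨ cong color middle-reversed ⟨
      color (toℕ (opposite (vertex t))) ≡⟨ cong (color ∘ toℕ) (reversed (vertex t)) ⟨
      color (toℕ (φ ⟨$⟩ʳ vertex t))     ≡⟨ preserves (vertex t) ⟩
      color (toℕ (vertex t))            ≡⟨ cong color (toℕ-vertex-≤ t≤M) ⟩
      color t                           ∎))
      where open ≡-Reasoning

  three-lists : 1 ≤ M → ListDistinguishableWith P 3
  three-lists 1≤M L = F ∘ toℕ , path-proper F step , distinguishing , respects-along (proj₁ L) F F∈
    where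
    a = proj₁ L (vertex 0) 0F
    open Greedy (proj₁ L ∘ vertex ∘ suc) (proj₂ L ∘ vertex ∘ suc) (a ∷ []) ≤-refl

    F : ℕ → ℕ
    F zero    = a
    F (suc j) = color j

    step : ∀ k → F (suc k) ≢ F k
    step zero    = color-∉-reserved 0 ∘ here
    step (suc k) = color-step k

    unique : ∀ k → 1 ≤ k → F k ≢ F 0
    unique (suc k) _ = color-∉-reserved k ∘ here

    F∈ : ∀ j → j ≤ M → F j ∈ₗ proj₁ L (vertex j)
    F∈ zero    _ = 0F , refl
    F∈ (suc j) _ = color-∈ j

    distinguishing : IsDistinguishing P (F ∘ toℕ)
    distinguishing φ φ-aut preserves with path-automorphism 1≤M {φ} φ-aut
    ... | inj₁ fixed    = fixed
    ... | inj₂ reversed = ⊥-elim (unique M 1≤M (begin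
      F M                           ≡⟨ cong F (toℕ-opposite (vertex 0)) ⟨
      F (toℕ (opposite (vertex 0))) ≡⟨ cong (F ∘ toℕ) (reversed (vertex 0)) ⟨
      F (toℕ (φ ⟨$⟩ʳ vertex 0))     ≡⟨ preserves (vertex 0) ⟩
      F 0                           ∎))
      where open ≡-Reasoning

  ProperAlong : (Fin N → Fin 2) → Set
  ProperAlong g = ∀ k → k < M → g (vertex k) ≢ g (vertex (suc k))

  proper-along-agree : ∀ g h → ProperAlong g → ProperAlong h → g (vertex 0) ≡ h (vertex 0) →
    ∀ k → k ≤ M → g (vertex k) ≡ h (vertex k)
  proper-along-agree g h g-proper h-proper g0≡h0 zero    _   = g0≡h0
  proper-along-agree g h g-proper h-proper g0≡h0 (suc k) k<M = two-colors
    (λ e → g-proper k k<M (trans (proper-along-agree g h g-proper h-proper g0≡h0 k (<⇒≤ k<M)) (sym e)))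
    (h-proper k k<M)

  proper-along-even : ∀ g → ProperAlong g → ∀ d → 2 * d ≤ M → g (vertex (2 * d)) ≡ g (vertex 0)
  proper-along-even g g-proper zero    _      = refl
  proper-along-even g g-proper (suc d) 2d+2≤M = begin
    g (vertex (2 * suc d)) ≡⟨ cong (g ∘ vertex) (*-suc 2 d) ⟩
    g (vertex (2 + 2 * d)) ≡⟨ two-colors (g-proper (1 + 2 * d) 2+2d≤M ∘ sym) (g-proper (2 * d) (<⇒≤ 2+2d≤M) ∘ sym) ⟩
    g (vertex (2 * d))     ≡⟨ proper-along-even g g-proper d (≤-trans (n≤1+n _) (<⇒≤ 2+2d≤M)) ⟩
    g (vertex 0)           ∎
    where
    open ≡-Reasoning
    2+2d≤M : 2 + 2 * d ≤ M
    2+2d≤M = subst (_≤ M) (*-suc 2 d) 2d+2≤M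

  odd-¬ProperDistinguishing₂ : ∀ d → M ≡ 2 * suc d → ¬ ProperDistinguishing {P} 2
  odd-¬ProperDistinguishing₂ d M≡ (g , proper , distinguishing) = 0≢1+n (begin
    0                         ≡⟨ cong toℕ (distinguishing reverse reversal-automorphism symmetric (vertex 0)) ⟨
    toℕ (opposite (vertex 0)) ≡⟨ toℕ-opposite (vertex 0) ⟩
    M                         ≡⟨ M≡ ⟩
    2 * suc d                 ∎)
    where
    open ≡-Reasoning
    differs : ∀ {u v} → Adj P u v → lookup g u ≢ lookup g v
    differs a = proper _ _ a ∘ cong toℕ

    g-proper : ProperAlong (lookup g)
    g-proper k k<M = differs (adj-vertex k k<M)

    reversed-proper : ProperAlong (lookup g ∘ opposite)
    reversed-proper k k<M = differs (proj₁ (reversal-automorphism _ _) (adj-vertex k k<M))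

    ends-agree : lookup g (vertex 0) ≡ lookup g (opposite (vertex 0))
    ends-agree = begin
      lookup g (vertex 0)         ≡⟨ proper-along-even (lookup g) g-proper (suc d) (≤-reflexive (sym M≡)) ⟨
      lookup g (vertex (2 * suc d)) ≡⟨ cong (lookup g ∘ vertex) M≡ ⟨
      lookup g (vertex M)         ≡⟨ cong (lookup g) (≡vertex (toℕ-opposite (vertex 0))) ⟨
      lookup g (opposite (vertex 0)) ∎

    symmetric : ∀ v → toℕ (lookup g (opposite v)) ≡ toℕ (lookup g v)
    symmetric v = cong toℕ (begin
      lookup g (opposite v)              ≡⟨ cong (lookup g ∘ opposite) (vertex-toℕ v) ⟨
      lookup g (opposite (vertex (toℕ v))) ≡⟨ proper-along-agree (lookup g) (lookup g ∘ opposite) g-proper reversed-proper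
                                                 ends-agree (toℕ v) (Fin.toℕ≤pred[n] v) ⟨
      lookup g (vertex (toℕ v))          ≡⟨ cong (lookup g) (vertex-toℕ v) ⟩
      lookup g v                         ∎)


even-path : ∀ t → χDL≡ (Path (2 * suc t)) 2
even-path t = χDL≡-intro (two-lists-even t M≡)
  (edge⇒¬ProperDistinguishing₁ (adj-vertex 0 0<M) ∘ ListDistinguishableWith⇒ProperDistinguishing)
  where
  open PathGraph (pred (2 * suc t))
  M≡ : pred (2 * suc t) ≡ t + suc t
  M≡ = cong (λ x → t + suc x) (+-identityʳ t)
  0<M : 0 < pred (2 * suc t)
  0<M = subst (0 <_) (sym M≡) (≤-trans (s≤s z≤n) (m≤n+m (suc t) t))

odd-path : ∀ t → χDL≡ (Path (2 * suc t + 1)) 3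
odd-path t = χDL≡-intro (three-lists (subst (1 ≤_) (sym M≡) (s≤s z≤n)))
  (odd-¬ProperDistinguishing₂ t M≡ ∘ ListDistinguishableWith⇒ProperDistinguishing)
  where
  open PathGraph (pred (2 * suc t + 1))
  M≡ : pred (2 * suc t + 1) ≡ 2 * suc t
  M≡ = cong pred (+-comm (2 * suc t) 1)

cycle-χ≡3 : ∀ N → 5 ≤ N → N ≢ 6 → χDL≡ (Cycle N) 3
cycle-χ≡3 (suc M) (s≤s 4≤M) N≢6 = χDL≡-intro (three-lists (identical-lists 4≤M (N≢6 ∘ cong suc)))
  (cycle-¬ProperDistinguishing₂ 2≤M ∘ ListDistinguishableWith⇒ProperDistinguishing)
  where
  2≤M = ≤-trans (n≤1+n 2) (≤-trans (n≤1+n 3) 4≤M)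
  open CycleGraph M
  open CycleColorings M 2≤M

large-cycle-χ≡3 : ∀ {N} → 7 ≤ N → χDL≡ (Cycle N) 3
large-cycle-χ≡3 7≤N = cycle-χ≡3 _ (≤-trans (n≤1+n 5) (≤-trans (n≤1+n 6) 7≤N)) (<⇒≢ 7≤N ∘ sym)

theorem2p7 : ((t : ℕ) → t ≥ 1 → χDL≡ (Path (2 * t)) 2 × χDL≡ (Path (2 * t + 1)) 3)
    × χDL≡ (Cycle 4) 4 × χDL≡ (Cycle 5) 3 × χDL≡ (Cycle 6) 4
    × ((m : ℕ) → m ≥ 3 → χDL≡ (Cycle (2 * m + 1)) 3)
    × ((n : ℕ) → n ≥ 4 → χDL≡ (Cycle (2 * n)) 3)
theorem2p7 =
  paths ,
  χDL≡-intro (CycleColorings.four-lists 3 (s≤s (s≤s z≤n)))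
    (C₄-¬ProperDistinguishing₃ ∘ ListDistinguishableWith⇒ProperDistinguishing) ,
  cycle-χ≡3 5 ≤-refl (λ ()) ,
  χDL≡-intro (CycleColorings.four-lists 5 (s≤s (s≤s z≤n)))
    (C₆-¬ProperDistinguishing₃ ∘ ListDistinguishableWith⇒ProperDistinguishing) ,
  (λ m m≥3 → large-cycle-χ≡3 (+-monoˡ-≤ 1 (*-monoʳ-≤ 2 m≥3))) ,
  (λ n n≥4 → large-cycle-χ≡3 (≤-trans (n≤1+n 7) (*-monoʳ-≤ 2 n≥4)))
  where
  paths : (t : ℕ) → t ≥ 1 → χDL≡ (Path (2 * t)) 2 × χDL≡ (Path (2 * t + 1)) 3
  paths (suc t) _ = even-path t , odd-path t
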